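{- Let $n\geq 1$ be an integer. Then $2n-1$ divides $\binom{6n}{3n}$. -}

module Defs where

module Submission where

-- For central binomial coefficients one has the recurrence
--     (m + 1) · C(2m + 2, m + 1)  =  2 (2m + 1) · C(2m, m),
-- which follows from the absorption identity k · C(N, k) = N · C(N - 1, k - 1)
-- and the symmetry C(2m + 1, m) = C(2m + 1, m + 1).  Applying it twice gives
--     (m + 1)(m + 2) · C(2m + 4, m + 2)  =  4 (2m + 3)(2m + 1) · C(2m, m).
-- For n = p + 1 take m = 3p + 1, so that m + 2 = 3n and 2m + 1 = 3 (2n - 1);
-- after cancelling the common factor 3 the identity reads
--     (3n - 1) · n · C(6n, 3n)  =  4 (6n - 1) C(6n - 4, 3n - 2) · (2n - 1).
-- Hence 2n - 1 divides (3n - 1) · n · C(6n, 3n), and since 2n - 1 is coprime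
-- to both 3n - 1 and n (witnessed by 2(3n - 1) = 3(2n - 1) + 1 and
-- 2n = (2n - 1) + 1), it divides C(6n, 3n).

open import Defs
open import Data.Nat using (ℕ; zero; suc; _+_; _*_; _∸_; _≥_)
open import Data.Nat.Properties using (*-zeroʳ; *-identityˡ; *-identityʳ; *-assoc; *-cancelˡ-≡; m≤m+n; +-suc; m+n∸m≡n; *-commutativeSemigroup)
open import Algebra.Properties.CommutativeSemigroup *-commutativeSemigroup using (x∙yz≈y∙xz)
open import Data.Nat.Divisibility using (_∣_; divides; ∣1⇒≡1; ∣m+n∣m⇒∣n; ∣n⇒∣m*n)
open import Data.Nat.Combinatorics using (_C_; nCk+nC[k+1]≡[n+1]C[k+1]; nC1≡n; nCk≡nC[n∸k])
open import Data.Nat.Coprimality using (Coprime; coprime-divisor)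
open import Data.Nat.Tactic.RingSolver using (solve-∀; solve)
open import Data.List.Base using (_∷_; [])
open import Data.Product using (_,_)
open import Relation.Binary.PropositionalEquality
  using (_≡_; refl; sym; trans; cong; cong₂; subst; subst₂; module ≡-Reasoning)

open ≡-Reasoning

absorption : ∀ n k → suc k * (suc n C suc k) ≡ suc n * (n C k)
absorption zero    zero    = refl
absorption zero    (suc k) = *-zeroʳ (suc (suc k))
absorption (suc n) zero    = trans (*-identityˡ _) (trans (nC1≡n (suc (suc n))) (sym (*-identityʳ _)))
absorption (suc n) (suc k) = begin
    suc (suc k) * (suc (suc n) C suc (suc k))
  ≡⟨ cong (suc (suc k) *_) (sym (nCk+nC[k+1]≡[n+1]C[k+1] (suc n) (suc k))) ⟩
    suc (suc k) * (suc n C suc k + suc n C suc (suc k))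
  ≡⟨ split (suc n C suc k) (suc n C suc (suc k)) ⟩
    suc n C suc k + suc k * (suc n C suc k) + suc (suc k) * (suc n C suc (suc k))
  ≡⟨ cong₂ (λ u v → suc n C suc k + u + v) (absorption n k) (absorption n (suc k)) ⟩
    suc n C suc k + suc n * (n C k) + suc n * (n C suc k)
  ≡⟨ merge (suc n C suc k) (n C k) (n C suc k) ⟩
    suc n C suc k + suc n * (n C k + n C suc k)
  ≡⟨ cong (λ u → suc n C suc k + suc n * u) (nCk+nC[k+1]≡[n+1]C[k+1] n k) ⟩
    suc (suc n) * (suc n C suc k)
  ∎
  where
  split : ∀ x y → (2 + k) * (x + y) ≡ x + (1 + k) * x + (2 + k) * y
  split = solve-∀
  merge : ∀ x y z → x + (1 + n) * y + (1 + n) * z ≡ x + (1 + n) * (y + z)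
  merge = solve-∀

-- Symmetry of binomial coefficients, phrased without truncated subtraction.
C-sym : ∀ a b → (a + b) C a ≡ (a + b) C b
C-sym a b = trans (nCk≡nC[n∸k] (m≤m+n a b)) (cong ((a + b) C_) (m+n∸m≡n a b))

-- Multiplied by m + 1 it is two absorptions around the symmetry
-- C(2m + 1, m) = C(2m + 1, m + 1); the factor m + 1 is then cancelled.
central-step : ∀ m → suc m * (2 * suc m C suc m) ≡ 2 * (1 + 2 * m) * (2 * m C m)
central-step m = *-cancelˡ-≡ _ _ (suc m) (begin
    suc m * (suc m * (2 * suc m C suc m))
  ≡⟨ cong (λ t → suc m * (suc m * (t C suc m))) (double-suc m) ⟩
    suc m * (suc m * (suc (suc (2 * m)) C suc m))
  ≡⟨ cong (suc m *_) (absorption (suc (2 * m)) m) ⟩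
    suc m * (suc (suc (2 * m)) * (suc (2 * m) C m))
  ≡⟨ cong (λ x → suc m * (suc (suc (2 * m)) * x)) odd-sym ⟩
    suc m * (suc (suc (2 * m)) * (suc (2 * m) C suc m))
  ≡⟨ x∙yz≈y∙xz (suc m) (suc (suc (2 * m))) (suc (2 * m) C suc m) ⟩
    suc (suc (2 * m)) * (suc m * (suc (2 * m) C suc m))
  ≡⟨ cong (suc (suc (2 * m)) *_) (absorption (2 * m) m) ⟩
    suc (suc (2 * m)) * (suc (2 * m) * (2 * m C m))
  ≡⟨ regroup m (2 * m C m) ⟩
    suc m * (2 * (1 + 2 * m) * (2 * m C m))
  ∎)
  where
  double-suc : ∀ k → 2 * suc k ≡ suc (suc (2 * k))
  double-suc = solve-∀
  odd-as-sum : ∀ k → k + suc k ≡ suc (2 * k)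
  odd-as-sum = solve-∀
  odd-sym : suc (2 * m) C m ≡ suc (2 * m) C suc m
  odd-sym = subst (λ t → t C m ≡ t C suc m) (odd-as-sum m) (C-sym m (suc m))
  regroup : ∀ k x → (2 + 2 * k) * ((1 + 2 * k) * x) ≡ (1 + k) * (2 * (1 + 2 * k) * x)
  regroup = solve-∀

central-two-steps : ∀ m →
  suc m * (suc (suc m) * (2 * suc (suc m) C suc (suc m)))
    ≡ 4 * (3 + 2 * m) * (1 + 2 * m) * (2 * m C m)
central-two-steps m = begin
    suc m * (suc (suc m) * (2 * suc (suc m) C suc (suc m)))
  ≡⟨ cong (suc m *_) (central-step (suc m)) ⟩
    suc m * (2 * (1 + 2 * suc m) * (2 * suc m C suc m))
  ≡⟨ x∙yz≈y∙xz (suc m) (2 * (1 + 2 * suc m)) (2 * suc m C suc m) ⟩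
    2 * (1 + 2 * suc m) * (suc m * (2 * suc m C suc m))
  ≡⟨ cong (2 * (1 + 2 * suc m) *_) (central-step m) ⟩
    2 * (1 + 2 * suc m) * (2 * (1 + 2 * m) * (2 * m C m))
  ≡⟨ regroup m (2 * m C m) ⟩
    4 * (3 + 2 * m) * (1 + 2 * m) * (2 * m C m)
  ∎
  where
  regroup : ∀ k x → 2 * (1 + 2 * suc k) * (2 * (1 + 2 * k) * x) ≡ 4 * (3 + 2 * k) * (1 + 2 * k) * x
  regroup = solve-∀

coprime-from-combination : ∀ {d m} a b → a * m ≡ b * d + 1 → Coprime d m
coprime-from-combination a b am≡bd+1 {i} (i∣d , i∣m) =
  ∣1⇒≡1 (∣m+n∣m⇒∣n (subst (i ∣_) am≡bd+1 (∣n⇒∣m*n a i∣m)) (∣n⇒∣m*n b i∣d))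

-- The theorem for n = p + 1, with 2n - 1 written as 1 + 2p.  Instantiating
-- central-two-steps at m = 3p + 1 and cancelling 3 shows that 1 + 2p divides
-- (2 + 3p) · (1 + p) · C(6n, 3n); both factors are coprime to 1 + 2p.
odd-divides-central : ∀ p → (1 + 2 * p) ∣ (2 * (3 * suc p) C (3 * suc p))
odd-divides-central p =
  coprime-divisor coprime-to-n (coprime-divisor coprime-to-3n-1 (divides quotient factored))
  where
  -- m = 3n - 2 is where the two-step recurrence is applied; B = C(6n, 3n).
  m B quotient : ℕ
  m = 1 + 3 * p
  B = 2 * (3 * suc p) C (3 * suc p)
  quotient = 4 * (3 + 2 * m) * (2 * m C m)

  three-n : 2 + (1 + 3 * p) ≡ 3 * suc p
  three-n = solve (p ∷ [])

  two-steps : suc m * (3 * suc p * B) ≡ 4 * (3 + 2 * m) * (1 + 2 * m) * (2 * m C m)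
  two-steps = subst (λ t → suc m * (t * (2 * t C t)) ≡ 4 * (3 + 2 * m) * (1 + 2 * m) * (2 * m C m))
                    three-n (central-two-steps m)

  factored : (2 + 3 * p) * (suc p * B) ≡ quotient * (1 + 2 * p)
  factored = *-cancelˡ-≡ _ _ 3 (begin
      3 * ((2 + 3 * p) * (suc p * B))      ≡⟨ pull-three p B ⟩
      suc m * (3 * suc p * B)              ≡⟨ two-steps ⟩
      4 * (3 + 2 * m) * (1 + 2 * m) * (2 * m C m)
                                           ≡⟨ push-three p (2 * m C m) ⟩
      3 * (quotient * (1 + 2 * p))         ∎)
    where
    pull-three : ∀ q x → 3 * ((2 + 3 * q) * (suc q * x)) ≡ (2 + 3 * q) * (3 * suc q * x)
    pull-three = solve-∀
    push-three : ∀ q x → 4 * (3 + 2 * (1 + 3 * q)) * (1 + 2 * (1 + 3 * q)) * x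
                           ≡ 3 * (4 * (3 + 2 * (1 + 3 * q)) * x * (1 + 2 * q))
    push-three = solve-∀

  coprime-to-3n-1 : Coprime (1 + 2 * p) (2 + 3 * p)
  coprime-to-3n-1 = coprime-from-combination {1 + 2 * p} {2 + 3 * p} 2 3 (solve (p ∷ []))

  coprime-to-n : Coprime (1 + 2 * p) (suc p)
  coprime-to-n = coprime-from-combination {1 + 2 * p} {suc p} 2 1 (solve (p ∷ []))

corollary1 : (n : ℕ) → n ≥ 1 → (2 * n ∸ 1) ∣ ((6 * n) C (3 * n))
corollary1 zero    ()
corollary1 (suc p) _  =
  subst₂ (λ d N → d ∣ (N C (3 * suc p))) odd-factor six-n (odd-divides-central p)
  where
  odd-factor : 1 + 2 * p ≡ 2 * suc p ∸ 1
  odd-factor = sym (+-suc p (p + 0))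
  six-n : 2 * (3 * suc p) ≡ 6 * suc p
  six-n = sym (*-assoc 2 3 (suc p))
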